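{- Let $d$ be a debate for $f_0, f_1, \Gamma, \varphi$. Then the depth of any interaction sequence $i=i_0i_1i_2\cdots$ associated to $d$ is at most $\nu$, where $\nu$ is the depth of $\varphi$.
   Context: Formulas are (possibly infinitary) formulas in negation normal form, viewed as well-founded trees $T(\varphi)$ with polarity; the depth $\mathrm{dt}(\sigma)$ of a node $\sigma$ is defined by $\mathrm{dt}(\langle\rangle)=0$, $\mathrm{dt}(\sigma i)=\mathrm{dt}(\sigma)$ if $\sigma i$ and $\sigma$ have the same polarity and $\mathrm{dt}(\sigma)+1$ otherwise. $\varphi$ is an $\bigvee$-formula of finite depth $\nu$, i.e. $\mathrm{dt}(\sigma)\le\nu$ for all $\sigma\in T(\varphi)$. A pointer sequence is $i_0i_1\cdots$ with $i_0=0$ and $i_{n+1}<n+1$; an interaction sequence is a pointer sequence with $i_{n+1}\in V(n+1)=\{n\}\cup V(i_n)$, $V(0)=\emptyset$. An interaction sequence has depth at most $\nu$ if for every $n$ the sequence $n\ i_n\ i_{i_n}\cdots 0$ has length $\le\nu+1$. A debate $d$ for $f_0,f_1,\Gamma,\varphi$ (with $f_0$ a strategy for Eloisa in the game $G(\Gamma,\neg\varphi)$ and $f_1$ one in $G(\Gamma,\varphi)$) assigns to sequences of moves $p$ rounds $d_s=(p_0,\sigma_0,i_0)\cdots(p_{n-1},\sigma_{n-1},i_{n-1})\,p_n$, where among other requirements $\sigma_m\in T(\varphi)$ for $m<n$ and $i_0\cdots i_{n-1}$ is an interaction sequence with $\mathrm{dt}(\sigma_{i_m})<\mathrm{dt}(\sigma_m)$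 for $0<m<n$; the interaction sequences associated to $d$ are these $i_0\cdots i_{n-1}$. -}

module Defs where

open import Data.Nat using (ℕ; zero; suc; _+_; _≤_; _<_)
open import Data.Bool using (Bool)
open import Data.Product using (Σ; _×_; ∃-syntax)
open import Relation.Binary.PropositionalEquality using (_≡_)

data Polarity : Set where
  ⋁pol ⋀pol : Polarity

-- Formulas over a type of atoms A.  A literal is an atom with a sign;
-- a compound node is an infinitary disjunction/conjunction indexed by
-- an arbitrary set I.
data Formula (A : Set) : Set₁ where
  lit  : Bool → A → Formula A
  node : Polarity → (I : Set) → (I → Formula A) → Formula A

-- Nodes of the tree T(φ): the root, or a child index followed by a node
-- of the corresponding subformula.
data Node {A : Set} : Formula A → Set₁ where
  root  : ∀ {φ} → Node φ
  child : ∀ {p I f} (j : I) → Node (f j) → Node (node p I f)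

-- increment of depth when passing from a node of polarity p to the
-- subformula ψ: 0 if same polarity (literals inherit parent's polarity), 1 otherwise
step : {A : Set} → Polarity → Formula A → ℕ
step p        (lit _ _)       = 0
step ⋁pol (node ⋁pol _ _) = 0
step ⋀pol (node ⋀pol _ _) = 0
step ⋁pol (node ⋀pol _ _) = 1
step ⋀pol (node ⋁pol _ _) = 1

dtFrom : {A : Set} → ℕ → (φ : Formula A) → Node φ → ℕ
dtFrom k φ              root        = k
dtFrom k (node p I f)   (child j σ) = dtFrom (k + step p (f j)) (f j) σ

dt : {A : Set} {φ : Formula A} → Node φ → ℕ
dt {φ = φ} σ = dtFrom 0 φ σ

IsBigOr : {A : Set} → Formula A → Set
IsBigOr (lit _ _)    = Data.Empty.⊥ where import Data.Empty
IsBigOr (node p _ _) = p ≡ ⋁pol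

HasDepth : {A : Set} → Formula A → ℕ → Set₁
HasDepth φ ν = ∀ (σ : Node φ) → dt σ ≤ ν

-- Pointer / interaction sequences (finite, of length n; i m for m < n)

IsPointer : ℕ → (ℕ → ℕ) → Set
IsPointer n i = (0 < n → i 0 ≡ 0) × (∀ m → suc m < n → i (suc m) < suc m)

-- V i m k : "k ∈ V(m)", with V(0) = ∅, V(m+1) = {m} ∪ V(i_m)
data V (i : ℕ → ℕ) : ℕ → ℕ → Set where
  here  : ∀ {m} → V i (suc m) m
  there : ∀ {m k} → V i (i m) k → V i (suc m) k

IsInteraction : ℕ → (ℕ → ℕ) → Set
IsInteraction n i = IsPointer n i × (∀ m → suc m < n → V i (suc m) (i (suc m)))

-- ChainLen i m k : the sequence m, i_m, i_{i_m}, …, 0 has length k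
data ChainLen (i : ℕ → ℕ) : ℕ → ℕ → Set where
  stop : ChainLen i 0 1
  next : ∀ {m k} → ChainLen i (i (suc m)) k → ChainLen i (suc m) (suc k)

DepthAtMost : ℕ → ℕ → (ℕ → ℕ) → Set
DepthAtMost n ν i = ∀ m → m < n → ∃[ k ] (ChainLen i m k × k ≤ suc ν)

-- Along a pointer chain m, i_m, i_{i_m}, …, 0 the depth dt(σ_·) strictly
-- decreases at every step before reaching 0, so the chain has at most
-- dt(σ_m) + 1 elements, and dt(σ_m) ≤ ν because φ has depth ν.
module Submission where

open import Defs
open import Data.Nat using (ℕ; zero; suc; _≤_; _<_; s≤s; z≤n)
open import Data.Nat.Properties using (≤-trans; <-trans)
open import Data.Nat.Induction using (<-wellFounded)
open import Data.Product using (_,_; ∃-syntax; _×_)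
open import Induction.WellFounded using (Acc; acc)

chainLen≤1+potential : (n : ℕ) (i : ℕ → ℕ) (h : ℕ → ℕ) → IsPointer n i →
  (∀ m → 0 < m → m < n → h (i m) < h m) →
  ∀ m → m < n → ∃[ k ] (ChainLen i m k × k ≤ suc (h m))
chainLen≤1+potential n i h (_ , pointsBack) decreasing m = go m (<-wellFounded m)
  where
  go : ∀ m → Acc _<_ m → m < n → ∃[ k ] (ChainLen i m k × k ≤ suc (h m))
  go zero    _        _    = 1 , stop , s≤s z≤n
  go (suc m) (acc rec) m<n with go (i (suc m)) (rec i<m) (<-trans i<m m<n)
    where i<m = pointsBack m m<n
  ... | k , chain , k≤ = suc k , next chain , s≤s (≤-trans k≤ (decreasing (suc m) (s≤s z≤n) m<n))

mainTheorem7 : {A : Set} (φ : Formula A) (ν : ℕ) → IsBigOr φ → HasDepth φ ν →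
    (n : ℕ) (σ : ℕ → Node φ) (i : ℕ → ℕ) →
    IsInteraction n i →
    (∀ m → 0 < m → m < n → dt (σ (i m)) < dt (σ m)) →
    DepthAtMost n ν i
mainTheorem7 φ ν _ depthν n σ i (pointer , _) decreasing m m<n
  with chainLen≤1+potential n i (λ m → dt (σ m)) pointer decreasing m m<n
... | k , chain , k≤ = k , chain , ≤-trans k≤ (s≤s (depthν (σ m)))
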